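{- Let $n,q$ be positive integers with $q\le n$ and let $B_q$ be the bipartite graph defined below. Then $\tau(B_q)=2n^q$, and every vertex cover of $B_q$ that does not contain $L$ has cardinality at least $3n^q$.
   Context: Fix a positive integer $n$ and an integer $q$ with $1\le q\le n$. The graph $B_q$ is bipartite with sides $L$ and $R=R_0\uplus R_1\uplus\cdots\uplus R_q$, where $|L|=2n^q$, $|R_0|=2n^q$, $|R_i|=n^q$ for $i=1,\dots,q$. Edges: (i) all pairs between $L$ and $R_q$; (ii) let $\mathcal L_q=\{L\}$ and for $i=q-1,\dots,1$ obtain the partition $\mathcal L_i$ of $L$ by splitting every part of $\mathcal L_{i+1}$ into $n$ parts of equal size, so $\mathcal L_i$ has $n^{q-i}$ parts of size $2n^i$; partition $R_i$ into $n^{q-i}$ parts of equal size $n^i$, pair the parts of $\mathcal L_i$ bijectively with the parts of $R_i$, and add all edges between each paired couple of parts; (iii) a perfect matching between $L$ and $R_0$. A vertex cover is a set of vertices meeting every edge; $\tau(B_q)$ is the minimum size of a vertex cover. -}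

module Defs where

open import Data.Nat using (ℕ; suc; _+_; _*_; _^_; _≤_; _<_)
open import Data.Fin using (Fin; toℕ)
open import Data.Product using (∃; _×_)
open import Data.Sum using (_⊎_)
open import Data.List using (List)
open import Data.List.Membership.Propositional using (_∈_)
open import Relation.Binary.PropositionalEquality using (_≡_)

-- Right-hand side R = R_0 ⊎ R_1 ⊎ ... ⊎ R_q of B_q.
--   r0 z      : z ∈ R_0,  z < 2 n^q
--   rlev j y  : y ∈ R_{j+1} (j : Fin q, so levels 1..q), y < n^q
data RightV (n q : ℕ) : Set where
  r0   : Fin (2 * n ^ q) → RightV n q
  rlev : (j : Fin q) → Fin (n ^ q) → RightV n q

data Vertex (n q : ℕ) : Set where
  left  : Fin (2 * n ^ q) → Vertex n q
  right : RightV n q → Vertex n q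

InBlock : ℕ → ℕ → ℕ → Set
InBlock s k x = (k * s ≤ x) × (x < suc k * s)

-- The level-i partition of L has parts {x : k·2n^i ≤ x < (k+1)·2n^i} (consecutive
-- blocks; refining each part of level i+1 into n equal parts), the level-i partition
-- of R_i has parts {y : k·n^i ≤ y < (k+1)·n^i}; the k-th parts are paired.
data Adj (n q : ℕ) : Fin (2 * n ^ q) → RightV n q → Set where
  top   : ∀ {x j y} → suc (toℕ j) ≡ q → Adj n q x (rlev j y)
  block : ∀ {x j y} → suc (toℕ j) < q →
          (∃ λ k → InBlock (2 * n ^ suc (toℕ j)) k (toℕ x)
                 × InBlock (n ^ suc (toℕ j)) k (toℕ y)) →
          Adj n q x (rlev j y)
  match : ∀ {x z} → toℕ x ≡ toℕ z → Adj n q x (r0 z)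

-- A vertex cover, given as a duplicate-free list of vertices (its cardinality is its length).
IsVertexCover : (n q : ℕ) → List (Vertex n q) → Set
IsVertexCover n q C = ∀ x r → Adj n q x r → (left x ∈ C) ⊎ (right r ∈ C)

ContainsL : (n q : ℕ) → List (Vertex n q) → Set
ContainsL n q C = ∀ x → left x ∈ C

-- The matching x ↦ x between L and R_0 has 2n^q edges, and a vertex cover must
-- contain a distinct endpoint of each of them; L itself is a cover of that size.
-- A cover missing some x ∈ L must contain all of R_q, since L–R_q is complete, and
-- R_q is disjoint from the matching edges, which adds n^q further vertices.
module Submission where

open import Defs
open import Data.Nat using (ℕ; suc; _+_; _*_; _^_; _≤_)
open import Data.Nat.Properties using (+-identityʳ; *-distribʳ-+)
open import Data.Fin as Fin using (Fin; splitAt; join)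
open import Data.Fin.Properties using (injective⇒≤; join-splitAt; ¬∀⟶∃¬; toℕ-fromℕ)
open import Data.Maybe using (Maybe; just; nothing)
open import Data.Maybe.Properties using (just-injective)
open import Data.Product using (Σ; _×_; _,_; proj₁; proj₂)
open import Data.Sum using (inj₁; inj₂; [_,_]′)
open import Data.List using (List; length; map; lookup; allFin)
open import Data.List.Properties using (length-map; length-tabulate)
open import Data.List.Membership.Propositional using (_∈_)
open import Data.List.Membership.Propositional.Properties using (∈-map⁺; ∈-allFin)
open import Data.List.Membership.DecPropositional using (_∈?_)
open import Data.List.Relation.Unary.Any using (index)
open import Data.List.Relation.Unary.Any.Properties using (lookup-index)
open import Data.List.Relation.Unary.Unique.Propositional using (Unique)
open import Data.List.Relation.Unary.Unique.Propositional.Properties using (map⁺; allFin⁺)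
open import Data.Empty using (⊥-elim)
open import Function using (_∘_; id)
open import Function.Definitions using (Injective)
open import Relation.Binary.Definitions using (DecidableEquality)
open import Relation.Nullary using (¬_; _×-dec_)
open import Relation.Nullary.Decidable using (map′; no)
open import Relation.Binary.PropositionalEquality
  using (_≡_; _≢_; refl; sym; trans; cong; subst; module ≡-Reasoning)

module _ {a} {A : Set a} where

  ∈-injection⇒≤length : ∀ {m} (xs : List A) {f : Fin m → A} →
    Injective _≡_ _≡_ f → (∀ i → f i ∈ xs) → m ≤ length xs
  ∈-injection⇒≤length xs {f} f-injective f∈xs = injective⇒≤ index-injective
    where
    open ≡-Reasoning
    index-injective : Injective _≡_ _≡_ (index ∘ f∈xs)
    index-injective {i} {j} eq = f-injective (begin
      f i                        ≡⟨ lookup-index (f∈xs i) ⟩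
      lookup xs (index (f∈xs i)) ≡⟨ cong (lookup xs) eq ⟩
      lookup xs (index (f∈xs j)) ≡⟨ lookup-index (f∈xs j) ⟨
      f j                        ∎)

  [,]-injective : ∀ {m k} {f : Fin m → A} {g : Fin k → A} →
    Injective _≡_ _≡_ f → Injective _≡_ _≡_ g → (∀ i j → f i ≢ g j) →
    Injective _≡_ _≡_ [ f , g ]′
  [,]-injective f-inj g-inj disjoint {inj₁ i} {inj₁ j} eq = cong inj₁ (f-inj eq)
  [,]-injective f-inj g-inj disjoint {inj₁ i} {inj₂ j} eq = ⊥-elim (disjoint i j eq)
  [,]-injective f-inj g-inj disjoint {inj₂ i} {inj₁ j} eq = ⊥-elim (disjoint j i (sym eq))
  [,]-injective f-inj g-inj disjoint {inj₂ i} {inj₂ j} eq = cong inj₂ (g-inj eq)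

  ∈-disjointInjections⇒+≤length : ∀ {m k} (xs : List A) {f : Fin m → A} {g : Fin k → A} →
    Injective _≡_ _≡_ f → Injective _≡_ _≡_ g → (∀ i j → f i ≢ g j) →
    (∀ i → f i ∈ xs) → (∀ j → g j ∈ xs) → m + k ≤ length xs
  ∈-disjointInjections⇒+≤length {m} {k} xs {f} {g} f-inj g-inj disjoint f∈xs g∈xs =
    ∈-injection⇒≤length xs (splitAt-injective ∘ [,]-injective f-inj g-inj disjoint)
      ([f,g]∈xs ∘ splitAt m)
    where
    [f,g]∈xs : ∀ u → [ f , g ]′ u ∈ xs
    [f,g]∈xs (inj₁ i) = f∈xs i
    [f,g]∈xs (inj₂ j) = g∈xs j

    splitAt-injective : Injective _≡_ _≡_ (splitAt m {k})
    splitAt-injective {i} {j} eq =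
      trans (sym (join-splitAt m k i)) (trans (cong (join m k) eq) (join-splitAt m k j))

leftSide : (n q : ℕ) → List (Vertex n q)
leftSide n q = map left (allFin (2 * n ^ q))

leftSide-unique : (n q : ℕ) → Unique (leftSide n q)
leftSide-unique n q = map⁺ (λ { refl → refl }) (allFin⁺ (2 * n ^ q))

leftSide-cover : (n q : ℕ) → IsVertexCover n q (leftSide n q)
leftSide-cover n q x _ _ = inj₁ (∈-map⁺ left (∈-allFin x))

length-leftSide : (n q : ℕ) → length (leftSide n q) ≡ 2 * n ^ q
length-leftSide n q = trans (length-map (left {n} {q}) (allFin _)) (length-tabulate (λ i → i))

module _ {n q : ℕ} where

  _≟ᴿ_ : DecidableEquality (RightV n q)
  r0 z ≟ᴿ r0 z′ = map′ (cong r0) (λ { refl → refl }) (z Fin.≟ z′)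
  r0 _ ≟ᴿ rlev _ _ = no λ ()
  rlev _ _ ≟ᴿ r0 _ = no λ ()
  rlev j y ≟ᴿ rlev j′ y′ =
    map′ (λ { (refl , refl) → refl }) (λ { refl → refl , refl }) ((j Fin.≟ j′) ×-dec (y Fin.≟ y′))

  _≟ⱽ_ : DecidableEquality (Vertex n q)
  left x ≟ⱽ left x′ = map′ (cong left) (λ { refl → refl }) (x Fin.≟ x′)
  left _ ≟ⱽ right _ = no λ ()
  right _ ≟ⱽ left _ = no λ ()
  right r ≟ⱽ right r′ = map′ (cong right) (λ { refl → refl }) (r ≟ᴿ r′)

  matchingEdge : Vertex n q → Maybe (Fin (2 * n ^ q))
  matchingEdge (left x)           = just x
  matchingEdge (right (r0 z))     = just z
  matchingEdge (right (rlev _ _)) = nothing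

  module _ {C : List (Vertex n q)} (cover : IsVertexCover n q C) where

    coveredEndpoint : ∀ x → Σ (Vertex n q) λ v → v ∈ C × matchingEdge v ≡ just x
    coveredEndpoint x =
      [ (λ p → left x , p , refl) , (λ p → right (r0 x) , p , refl) ]′ (cover x (r0 x) (match refl))

    endpoint : Fin (2 * n ^ q) → Vertex n q
    endpoint = proj₁ ∘ coveredEndpoint

    endpoint∈ : ∀ x → endpoint x ∈ C
    endpoint∈ = proj₁ ∘ proj₂ ∘ coveredEndpoint

    matchingEdge-endpoint : ∀ x → matchingEdge (endpoint x) ≡ just x
    matchingEdge-endpoint = proj₂ ∘ proj₂ ∘ coveredEndpoint

    endpoint-injective : Injective _≡_ _≡_ endpoint
    endpoint-injective {x} {x′} eq = just-injective
      (trans (sym (matchingEdge-endpoint x))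
        (trans (cong matchingEdge eq) (matchingEdge-endpoint x′)))

    endpoint≢level : ∀ x j y → endpoint x ≢ right (rlev j y)
    endpoint≢level x j y eq with () ← trans (sym (matchingEdge-endpoint x)) (cong matchingEdge eq)

    cover-length-≥ : 2 * n ^ q ≤ length C
    cover-length-≥ = ∈-injection⇒≤length C endpoint-injective endpoint∈

    uncovered⇒topLevel∈ : ∀ {x j} → ¬ left x ∈ C → suc (Fin.toℕ j) ≡ q →
      ∀ y → right (rlev j y) ∈ C
    uncovered⇒topLevel∈ {x} x∉C top-j y = [ (λ x∈C → ⊥-elim (x∉C x∈C)) , id ]′
      (cover x (rlev _ y) (top top-j))

    uncovered⇒cover-length-≥ : ∀ {x j} → ¬ left x ∈ C → suc (Fin.toℕ j) ≡ q →
      2 * n ^ q + n ^ q ≤ length C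
    uncovered⇒cover-length-≥ {j = j} x∉C top-j = ∈-disjointInjections⇒+≤length C
      endpoint-injective (λ { refl → refl }) (λ x y → endpoint≢level x j y)
      endpoint∈ (uncovered⇒topLevel∈ x∉C top-j)

proposition13 : (n q : ℕ) → 1 ≤ q → q ≤ n →
    ((Σ (List (Vertex n q)) λ C → Unique C × IsVertexCover n q C × length C ≡ 2 * n ^ q)
     × (∀ (C : List (Vertex n q)) → Unique C → IsVertexCover n q C → 2 * n ^ q ≤ length C))
    × (∀ (C : List (Vertex n q)) → Unique C → IsVertexCover n q C → ¬ ContainsL n q C →
         3 * n ^ q ≤ length C)
proposition13 n q@(suc q′) _ _ =
  ( (leftSide n q , leftSide-unique n q , leftSide-cover n q , length-leftSide n q)
  , λ _ _ → cover-length-≥) ,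
  λ C _ cover L⊈C →
    let (x , x∉C) = ¬∀⟶∃¬ _ (λ x → left x ∈ C) (λ x → _∈?_ _≟ⱽ_ (left x) C) L⊈C
    in subst (_≤ length C) (2m+m≡3m (n ^ q))
         (uncovered⇒cover-length-≥ cover x∉C (cong suc (toℕ-fromℕ q′)))
  where
  2m+m≡3m : ∀ m → 2 * m + m ≡ 3 * m
  2m+m≡3m m = trans (cong (2 * m +_) (sym (+-identityʳ m))) (sym (*-distribʳ-+ m 2 1))
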